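{- Let $m\ge2$ and let $\mathcal{B}_R(m)$ be the homogeneous tree of degree $m+1$ whose basin $\mathcal{P}$ is a single edge with endpoints $\mathcal{O}_0$ and $\mathcal{O}'$. Let $\mathcal{O}_0,\mathcal{O}_1,\mathcal{O}_2,\dots$ be the consecutive vertices of a geodesic ray from $\mathcal{O}_0$ not passing through $\mathcal{O}'$ (so $h(\mathcal{O}_n)=n$). Then for every $n\ge1$, $$\zeta_{\mathcal{O}_n}(X)=\frac{1-X+mX^2-mX^3+\cdots+m^{n-1}X^{2n-2}-m^{n-1}X^{2n-1}+m^nX^{2n}}{1-X},$$ $$\zeta^{\mathcal{P}}_{\mathcal{O}_n}(X)=\frac{1+mX^2+m^2X^4+\cdots+m^nX^{2n}}{1-X}.$$
   Context: For a tree with basin $\mathcal{P}$: $\mathcal{P}_0=\mathcal{P}$, $\mathcal{P}_n=\{x: d(x,\mathcal{P}_{n-1})\le1\}$, $\mathcal{R}_0=\mathcal{P}$, $\mathcal{R}_n=\mathcal{P}_n\setminus\mathcal{P}_{n-1}$, $h(v)$ the unique $n$ with $v\in\mathcal{R}_n$. $\zeta_v(X)=\sum_{d\ge0}\#\{x\in\mathcal{R}_{h(v)}: x \text{ reachable from } v \text{ by a path of length } d\}X^d$, and $\zeta^{\mathcal{P}}_v(X)$ is the same with $\mathcal{P}_{h(v)}$ in place of $\mathcal{R}_{h(v)}$; paths are walks, possibly backtracking. -}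

module Defs where

open import Data.Nat using (ℕ; zero; suc; _+_; _*_; _^_; _≤_; _≟_)
open import Data.Integer using (ℤ; +_; -_; _-_) renaming (_+_ to _+ℤ_)
open import Data.Fin using (Fin)
open import Data.Bool using (Bool; true; false)
open import Data.List using (List; []; _∷_; length)
open import Data.List.Membership.Propositional using (_∈_)
open import Data.List.Relation.Unary.Unique.Propositional using (Unique)
open import Data.Product using (Σ; _×_; _,_)
open import Data.Sum using (_⊎_)
open import Relation.Nullary using (¬_; yes; no)
open import Relation.Binary.PropositionalEquality using (_≡_)

module GraphNotions {V : Set} (Adj : V → V → Set) (Basin : V → Set) where

  InP : ℕ → V → Set
  InP zero    x = Basin x
  InP (suc n) x = Σ V λ y → InP n y × (x ≡ y ⊎ Adj x y)

  InR : ℕ → V → Set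
  InR zero    x = Basin x
  InR (suc n) x = InP (suc n) x × ¬ InP n x

  -- walks (possibly backtracking) of length d
  data Walk : ℕ → V → V → Set where
    nil  : ∀ {v} → Walk zero v v
    cons : ∀ {d u w x} → Adj u w → Walk d w x → Walk (suc d) u x

  Reachable : ℕ → V → V → Set
  Reachable d v x = Walk d v x

  HasCard : (V → Set) → ℕ → Set
  HasCard Q c = Σ (List V) λ L →
    Unique L × ((∀ x → x ∈ L → Q x) × (∀ x → Q x → x ∈ L)) × length L ≡ c

  -- h(v) = k, i.e. v ∈ ℛ_k
  -- c is the coefficient sequence of ζ_v(X)
  IsZeta : V → (ℕ → ℕ) → Set
  IsZeta v c = Σ ℕ λ k → InR k v ×
    (∀ d → HasCard (λ x → InR k x × Reachable d v x) (c d))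

  IsZetaP : V → (ℕ → ℕ) → Set
  IsZetaP v c = Σ ℕ λ k → InR k v ×
    (∀ d → HasCard (λ x → InP k x × Reachable d v x) (c d))

-- Vertices: (side, path) ; side true = component of 𝒪₀, false = of 𝒪'
-- after removing the basin edge; path = sequence of child choices
-- (most recent first) going away from the basin.

BVertex : ℕ → Set
BVertex m = Bool × List (Fin m)

data BAdj (m : ℕ) : BVertex m → BVertex m → Set where
  down   : ∀ {s l} (i : Fin m) → BAdj m (s , l) (s , i ∷ l)
  up     : ∀ {s l} (i : Fin m) → BAdj m (s , i ∷ l) (s , l)
  cross  : BAdj m (true , []) (false , [])
  cross' : BAdj m (false , []) (true , [])

BBasin : (m : ℕ) → BVertex m → Set
BBasin m (s , l) = l ≡ []

O₀ : (m : ℕ) → BVertex m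
O₀ m = (true , [])

O' : (m : ℕ) → BVertex m
O' m = (false , [])

rayPath : {m : ℕ} → (ℕ → Fin m) → ℕ → List (Fin m)
rayPath ray zero    = []
rayPath ray (suc k) = ray k ∷ rayPath ray k

rayVertex : {m : ℕ} → (ℕ → Fin m) → ℕ → BVertex m
rayVertex ray n = (true , rayPath ray n)

PS : Set
PS = ℕ → ℤ

toPS : (ℕ → ℕ) → PS
toPS c d = + (c d)

oneMinusX· : PS → PS
oneMinusX· f zero    = f zero
oneMinusX· f (suc d) = f (suc d) - f d

mono : ℤ → ℕ → PS
mono a k d with d ≟ k
... | yes _ = a
... | no  _ = + 0

_⊕_ : PS → PS → PS
(f ⊕ g) d = f d +ℤ g d

zeroPS : PS
zeroPS _ = + 0

sumPS : ℕ → (ℕ → PS) → PS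
sumPS zero    f = zeroPS
sumPS (suc n) f = sumPS n f ⊕ f n

numR : ℕ → ℕ → PS
numR m n = sumPS n (λ k → mono (+ (m ^ k)) (2 * k) ⊕ mono (- (+ (m ^ k))) (2 * k + 1))
           ⊕ mono (+ (m ^ n)) (2 * n)

numP : ℕ → ℕ → PS
numP m n = sumPS (suc n) (λ k → mono (+ (m ^ k)) (2 * k))

-- A walk of length d from u to x exists iff dist(u, x) ≤ d and dist(u, x) ≡ d
-- (mod 2), since the tree is bipartite and a walk can idle on an edge.  A vertex
-- of depth n on 𝒪ₙ's side of the basin edge is at distance 2k from 𝒪ₙ, k being
-- the number of top letters in which the two words differ, so m^min(j,n) of them
-- lie within distance 2j; the m^n vertices of depth n across the edge are at
-- distance 2n + 1.  The vertices of 𝒫ₙ reachable in d steps correspond to the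
-- words p with |p| ≤ min(⌊d/2⌋, n): climb d − |p| steps from 𝒪ₙ, turning at the
-- basin edge if the root comes first, then descend along p.  So ζ has coefficient
-- m^min(j,n) at X^2j and [n ≤ j] m^n at X^(2j+1), ζ^𝒫 has Σ_{k ≤ min(⌊d/2⌋,n)} m^k
-- at X^d, and multiplying by 1 − X is a coefficientwise check.

module Submission where

open import Defs
import Data.Integer.Properties as ℤ
open import Algebra.Properties.CommutativeSemigroup ℤ.+-commutativeSemigroup using (interchange)
open import Data.Bool using (Bool; true; false; not; if_then_else_)
open import Data.Bool.Properties using (¬-not; not-involutive)
open import Data.Empty using (⊥-elim)
open import Data.Fin using (Fin)
open import Data.Integer using (ℤ; +_; -_; _-_) renaming (_+_ to _+ℤ_)
open import Data.List using (List; []; _∷_; [_]; length; map; _++_; take; drop; allFin; cartesianProductWith)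
open import Data.List.Membership.Propositional using (_∈_)
open import Data.List.Membership.Propositional.Properties using (∈-map⁺; ∈-map⁻; ∈-++⁺ˡ; ∈-++⁺ʳ; ∈-++⁻; ∈-allFin; ∈-cartesianProductWith⁺; ∈-cartesianProductWith⁻)
open import Data.List.Properties using (length-map; length-++; length-tabulate; length-take; length-drop; ++-assoc; ++-identityʳ; ++-cancelʳ; take++drop≡id; take-all; ∷-injective)
open import Data.List.Relation.Unary.All using ([])
open import Data.List.Relation.Unary.Any using (here)
open import Data.List.Relation.Unary.Unique.Propositional using (Unique; []; _∷_)
import Data.List.Relation.Unary.Unique.Propositional.Properties as Unique
open import Data.Nat using (ℕ; zero; suc; _+_; _*_; _^_; _∸_; _⊓_; _≤_; _<_; _≤ᵇ_; z≤n; s≤s; _≟_; _≤?_; _<?_; parity; ⌊_/2⌋)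
open import Data.Nat.Properties
open import Data.Nat.Tactic.RingSolver using (solve-∀)
open import Data.Parity.Base using (Parity; 0ℙ; 1ℙ)
open import Data.Product using (Σ; _×_; _,_; proj₁; proj₂)
open import Data.Product.Function.NonDependent.Propositional using (_×-⇔_)
open import Data.Sum using (inj₁; inj₂)
open import Function.Base using (_∘_; _∘′_)
open import Function.Bundles using (_⇔_; mk⇔; Equivalence)
import Function.Properties.Equivalence as ⇔
open import Relation.Binary.Definitions using (tri<; tri≈; tri>)
open import Relation.Nullary using (Dec; yes; no; ¬_)
open import Relation.Binary.PropositionalEquality hiding ([_])

2*-suc : ∀ j → 2 * suc j ≡ suc (suc (2 * j))
2*-suc j = cong suc (+-suc j (j + 0))

data EvenOdd : ℕ → Set where
  even : ∀ j → EvenOdd (2 * j)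
  odd  : ∀ j → EvenOdd (suc (2 * j))

evenOdd : ∀ d → EvenOdd d
evenOdd zero = even 0
evenOdd (suc d) with evenOdd d
... | even j = odd j
... | odd j  = subst EvenOdd (2*-suc j) (even (suc j))

parity-even : ∀ j → parity (2 * j) ≡ 0ℙ
parity-even zero    = refl
parity-even (suc j) = trans (cong parity (2*-suc j)) (parity-even j)

parity-odd : ∀ j → parity (suc (2 * j)) ≡ 1ℙ
parity-odd zero    = refl
parity-odd (suc j) = trans (cong (parity ∘′ suc) (2*-suc j)) (parity-odd j)

⌊2*n/2⌋≡n : ∀ j → ⌊ 2 * j /2⌋ ≡ j
⌊2*n/2⌋≡n zero    = refl
⌊2*n/2⌋≡n (suc j) = trans (cong ⌊_/2⌋ (2*-suc j)) (cong suc (⌊2*n/2⌋≡n j))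

⌊1+2*n/2⌋≡n : ∀ j → ⌊ suc (2 * j) /2⌋ ≡ j
⌊1+2*n/2⌋≡n zero    = refl
⌊1+2*n/2⌋≡n (suc j) = trans (cong (λ d → ⌊ suc d /2⌋) (2*-suc j)) (cong suc (⌊1+2*n/2⌋≡n j))

2*⌊n/2⌋≤n : ∀ d → 2 * ⌊ d /2⌋ ≤ d
2*⌊n/2⌋≤n d with evenOdd d
... | even j = ≤-reflexive (cong (2 *_) (⌊2*n/2⌋≡n j))
... | odd j  = m≤n⇒m≤1+n (≤-reflexive (cong (2 *_) (⌊1+2*n/2⌋≡n j)))

2*m≤n⇒m≤⌊n/2⌋ : ∀ {k d} → 2 * k ≤ d → k ≤ ⌊ d /2⌋
2*m≤n⇒m≤⌊n/2⌋ {k} 2k≤d = subst (_≤ _) (⌊2*n/2⌋≡n k) (⌊n/2⌋-mono 2k≤d)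

m≤⌊n/2⌋⇒2*m≤n : ∀ {k d} → k ≤ ⌊ d /2⌋ → 2 * k ≤ d
m≤⌊n/2⌋⇒2*m≤n {d = d} k≤ = ≤-trans (*-monoʳ-≤ 2 k≤) (2*⌊n/2⌋≤n d)

2*m≤n+m : ∀ {a b} → a ≤ b → 2 * a ≤ b + a
2*m≤n+m {a} {b} a≤b = subst (_≤ b + a) (cong (λ x → a + x) (sym (+-identityʳ a))) (+-monoˡ-≤ a a≤b)

strictlyIncreasing-injective : ∀ (f : ℕ → ℕ) → (∀ {a b} → a < b → f a < f b) →
                               ∀ {a b} → f a ≡ f b → a ≡ b
strictlyIncreasing-injective f f-mono {a} {b} fa≡fb with <-cmp a b
... | tri< a<b _ _ = ⊥-elim (<-irrefl fa≡fb (f-mono a<b))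
... | tri≈ _ a≡b _ = a≡b
... | tri> _ _ b<a = ⊥-elim (<-irrefl (sym fa≡fb) (f-mono b<a))

2*-injective : ∀ {i k} → 2 * i ≡ 2 * k → i ≡ k
2*-injective {i} {k} = *-cancelˡ-≡ i k 2

2*+1-injective : ∀ {i k} → 2 * i + 1 ≡ 2 * k + 1 → i ≡ k
2*+1-injective {i} {k} eq = 2*-injective (+-cancelʳ-≡ 1 (2 * i) (2 * k) eq)

even≢2*+1 : ∀ j k → 2 * j ≢ 2 * k + 1
even≢2*+1 j k eq = even≢odd j k (trans eq (+-comm (2 * k) 1))

length-cartesianProductWith : ∀ {A B C : Set} (f : A → B → C) xs ys →
  length (cartesianProductWith f xs ys) ≡ length xs * length ys
length-cartesianProductWith f []       ys = refl
length-cartesianProductWith f (x ∷ xs) ys =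
  trans (length-++ (map (f x) ys))
        (cong₂ _+_ (length-map (f x) ys) (length-cartesianProductWith f xs ys))

take-length-++ : ∀ {A : Set} (xs ys : List A) → take (length xs) (xs ++ ys) ≡ xs
take-length-++ []       ys = refl
take-length-++ (x ∷ xs) ys = cong (x ∷_) (take-length-++ xs ys)

length-take-≤ : ∀ {A : Set} {i} (l : List A) → i ≤ length l → length (take i l) ≡ i
length-take-≤ {i = i} l i≤ = trans (length-take i l) (m≤n⇒m⊓n≡m i≤)

drop-length-++ : ∀ {A : Set} (xs : List A) k ys → drop (length xs + k) (xs ++ ys) ≡ drop k ys
drop-length-++ []       k ys = refl
drop-length-++ (x ∷ xs) k ys = drop-length-++ xs k ys

drop-++-common : ∀ {A : Set} (xs ys zs : List A) {k} → length xs ≡ length ys → length xs ≤ k →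
                 drop k (xs ++ zs) ≡ drop k (ys ++ zs)
drop-++-common xs ys zs {k} |xs|≡|ys| |xs|≤k = begin
  drop k (xs ++ zs)               ≡⟨ cong (λ i → drop i (xs ++ zs)) (sym (m+[n∸m]≡n |xs|≤k)) ⟩
  drop (length xs + t) (xs ++ zs) ≡⟨ drop-length-++ xs t zs ⟩
  drop t zs                       ≡⟨ sym (drop-length-++ ys t zs) ⟩
  drop (length ys + t) (ys ++ zs) ≡⟨ cong (λ i → drop (i + t) (ys ++ zs)) (sym |xs|≡|ys|) ⟩
  drop (length xs + t) (ys ++ zs) ≡⟨ cong (λ i → drop i (ys ++ zs)) (m+[n∸m]≡n |xs|≤k) ⟩
  drop k (ys ++ zs)               ∎
  where
  open ≡-Reasoning
  t = k ∸ length xs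

powSum : ℕ → ℕ → ℕ
powSum m zero    = 1
powSum m (suc K) = powSum m K + m ^ suc K

module Words (m : ℕ) where

  words : ℕ → List (List (Fin m))
  words zero    = [ [] ]
  words (suc k) = cartesianProductWith _∷_ (allFin m) (words k)

  length-words : ∀ k → length (words k) ≡ m ^ k
  length-words zero    = refl
  length-words (suc k) = trans (length-cartesianProductWith _∷_ (allFin m) (words k))
                               (cong₂ _*_ (length-tabulate {n = m} (λ i → i)) (length-words k))

  ∈-words⁻ : ∀ k {p} → p ∈ words k → length p ≡ k
  ∈-words⁻ zero    (here refl) = refl
  ∈-words⁻ (suc k) p∈ with ∈-cartesianProductWith⁻ _∷_ (allFin m) (words k) p∈
  ... | _ , _ , _ , q∈ , refl = cong suc (∈-words⁻ k q∈)

  ∈-words⁺ : ∀ p → p ∈ words (length p)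
  ∈-words⁺ []      = here refl
  ∈-words⁺ (i ∷ p) = ∈-cartesianProductWith⁺ _∷_ (∈-allFin i) (∈-words⁺ p)

  words-unique : ∀ k → Unique (words k)
  words-unique zero    = [] ∷ []
  words-unique (suc k) = Unique.cartesianProductWith⁺ _∷_ ∷-injective (Unique.allFin⁺ m) (words-unique k)

  wordsUpTo : ℕ → List (List (Fin m))
  wordsUpTo zero    = words 0
  wordsUpTo (suc K) = wordsUpTo K ++ words (suc K)

  ∈-wordsUpTo⁻ : ∀ K {p} → p ∈ wordsUpTo K → length p ≤ K
  ∈-wordsUpTo⁻ zero    p∈ = ≤-reflexive (∈-words⁻ 0 p∈)
  ∈-wordsUpTo⁻ (suc K) p∈ with ∈-++⁻ (wordsUpTo K) p∈
  ... | inj₁ p∈K = m≤n⇒m≤1+n (∈-wordsUpTo⁻ K p∈K)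
  ... | inj₂ p∈  = ≤-reflexive (∈-words⁻ (suc K) p∈)

  ∈-wordsUpTo⁺ : ∀ {K} p → length p ≤ K → p ∈ wordsUpTo K
  ∈-wordsUpTo⁺ {zero}  [] _ = here refl
  ∈-wordsUpTo⁺ {suc K} p p≤ with m≤n⇒m<n∨m≡n p≤
  ... | inj₁ p<  = ∈-++⁺ˡ (∈-wordsUpTo⁺ p (≤-pred p<))
  ... | inj₂ p≡  = ∈-++⁺ʳ (wordsUpTo K) (subst (λ k → p ∈ words k) p≡ (∈-words⁺ p))

  wordsUpTo-unique : ∀ K → Unique (wordsUpTo K)
  wordsUpTo-unique zero    = words-unique 0
  wordsUpTo-unique (suc K) = Unique.++⁺ (wordsUpTo-unique K) (words-unique (suc K)) disjoint
    where
    disjoint : ∀ {p} → ¬ (p ∈ wordsUpTo K × p ∈ words (suc K))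
    disjoint (p∈K , p∈) = 1+n≰n (subst (_≤ K) (∈-words⁻ (suc K) p∈) (∈-wordsUpTo⁻ K p∈K))

  length-wordsUpTo : ∀ K → length (wordsUpTo K) ≡ powSum m K
  length-wordsUpTo zero    = refl
  length-wordsUpTo (suc K) = trans (length-++ (wordsUpTo K)) (cong₂ _+_ (length-wordsUpTo K) (length-words (suc K)))

mono-≡ : ∀ a {k d} → d ≡ k → mono a k d ≡ a
mono-≡ a {k} {d} d≡k with d ≟ k
... | yes _   = refl
... | no d≢k = ⊥-elim (d≢k d≡k)

mono-≢ : ∀ a {k d} → d ≢ k → mono a k d ≡ + 0
mono-≢ a {k} {d} d≢k with d ≟ k
... | yes d≡k = ⊥-elim (d≢k d≡k)
... | no _    = refl

sumPS-⊕ : ∀ N f g d → sumPS N (λ k → f k ⊕ g k) d ≡ sumPS N f d +ℤ sumPS N g d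
sumPS-⊕ zero    f g d = refl
sumPS-⊕ (suc N) f g d =
  trans (cong (_+ℤ (f N d +ℤ g N d)) (sumPS-⊕ N f g d)) (interchange (sumPS N f d) (sumPS N g d) (f N d) (g N d))

module _ (a : ℕ → ℤ) (e : ℕ → ℕ) where

  sumPS-mono-∉ : ∀ N {d} → (∀ k → k < N → d ≢ e k) → sumPS N (λ k → mono (a k) (e k)) d ≡ + 0
  sumPS-mono-∉ zero    ∉ = refl
  sumPS-mono-∉ (suc N) ∉ =
    cong₂ _+ℤ_ (sumPS-mono-∉ N (λ k k<N → ∉ k (m<n⇒m<1+n k<N))) (mono-≢ (a N) (∉ N ≤-refl))

  sumPS-mono-∈ : (∀ {i k} → e i ≡ e k → i ≡ k) →
                 ∀ N {j d} → j < N → d ≡ e j → sumPS N (λ k → mono (a k) (e k)) d ≡ a j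
  sumPS-mono-∈ e-inj (suc N) {j} j<1+N d≡ej with j ≟ N
  ... | yes refl = trans (cong₂ _+ℤ_ (sumPS-mono-∉ j (λ k k<j d≡ek → <-irrefl (e-inj (trans (sym d≡ek) d≡ej)) k<j))
                                     (mono-≡ (a j) d≡ej))
                         (ℤ.+-identityˡ (a j))
  ... | no j≢N   = trans (cong₂ _+ℤ_ (sumPS-mono-∈ e-inj N (≤∧≢⇒< (≤-pred j<1+N) j≢N) d≡ej)
                                     (mono-≢ (a N) (λ d≡eN → j≢N (e-inj (trans (sym d≡ej) d≡eN)))))
                         (ℤ.+-identityʳ (a j))

module Numerators (m n : ℕ) where

  evenTerm oddTerm : ℕ → PS
  evenTerm k = mono (+ (m ^ k)) (2 * k)
  oddTerm  k = mono (- (+ (m ^ k))) (2 * k + 1)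

  private
    evenSum = sumPS-mono-∉ (λ k → + (m ^ k)) (2 *_)
    oddSum  = sumPS-mono-∉ (λ k → - (+ (m ^ k))) (λ k → 2 * k + 1)
    evenHit = sumPS-mono-∈ (λ k → + (m ^ k)) (2 *_) 2*-injective
    oddHit  = sumPS-mono-∈ (λ k → - (+ (m ^ k))) (λ k → 2 * k + 1) 2*+1-injective

  numR-coeff : ∀ d {a b c} → sumPS n evenTerm d ≡ a → sumPS n oddTerm d ≡ b →
               mono (+ (m ^ n)) (2 * n) d ≡ c → numR m n d ≡ (a +ℤ b) +ℤ c
  numR-coeff d ea eb ec =
    trans (cong (_+ℤ mono (+ (m ^ n)) (2 * n) d) (sumPS-⊕ n evenTerm oddTerm d))
          (cong₂ _+ℤ_ (cong₂ _+ℤ_ ea eb) ec)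

  numR-even-< : ∀ {j} → j < n → numR m n (2 * j) ≡ + (m ^ j)
  numR-even-< {j} j<n = trans
    (numR-coeff (2 * j) (evenHit n j<n refl) (oddSum n (λ k _ → even≢2*+1 j k))
                          (mono-≢ _ (λ eq → <⇒≢ j<n (2*-injective eq))))
    (trans (ℤ.+-identityʳ _) (ℤ.+-identityʳ _))

  numR-even-≡ : numR m n (2 * n) ≡ + (m ^ n)
  numR-even-≡ = trans
    (numR-coeff (2 * n) (evenSum n (λ k k<n eq → <⇒≢ k<n (sym (2*-injective eq))))
                          (oddSum n (λ k _ → even≢2*+1 n k)) (mono-≡ (+ (m ^ n)) {2 * n} {2 * n} refl))
    (ℤ.+-identityˡ _)

  numR-even-≤ : ∀ {j} → j ≤ n → numR m n (2 * j) ≡ + (m ^ j)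
  numR-even-≤ j≤n with m≤n⇒m<n∨m≡n j≤n
  ... | inj₁ j<n  = numR-even-< j<n
  ... | inj₂ refl = numR-even-≡

  numR-even-> : ∀ {j} → n < j → numR m n (2 * j) ≡ + 0
  numR-even-> {j} n<j =
    numR-coeff (2 * j) (evenSum n (λ k k<n eq → <⇒≢ (<-trans k<n n<j) (sym (2*-injective eq))))
                         (oddSum n (λ k _ → even≢2*+1 j k)) (mono-≢ _ (λ eq → >⇒≢ n<j (2*-injective eq)))

  numR-odd-< : ∀ {j} → j < n → numR m n (suc (2 * j)) ≡ - (+ (m ^ j))
  numR-odd-< {j} j<n = trans
    (numR-coeff (suc (2 * j)) (evenSum n (λ k _ eq → even≢odd k j (sym eq)))
                                (oddHit n j<n (+-comm 1 (2 * j))) (mono-≢ _ (λ eq → even≢odd n j (sym eq))))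
    (trans (ℤ.+-identityʳ _) (ℤ.+-identityˡ _))

  numR-odd-≥ : ∀ {j} → n ≤ j → numR m n (suc (2 * j)) ≡ + 0
  numR-odd-≥ {j} n≤j =
    numR-coeff (suc (2 * j)) (evenSum n (λ k _ eq → even≢odd k j (sym eq)))
                               (oddSum n (λ k k<n eq → <⇒≢ (<-≤-trans k<n n≤j)
                                            (2*+1-injective (trans (sym eq) (+-comm 1 (2 * j))))))
                               (mono-≢ _ (λ eq → even≢odd n j (sym eq)))

  numP-even-≤ : ∀ {j} → j ≤ n → numP m n (2 * j) ≡ + (m ^ j)
  numP-even-≤ j≤n = evenHit _ (s≤s j≤n) refl

  numP-even-> : ∀ {j} → n < j → numP m n (2 * j) ≡ + 0
  numP-even-> n<j = evenSum _ (λ k k≤n eq → <⇒≢ (≤-<-trans (≤-pred k≤n) n<j) (sym (2*-injective eq)))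

  numP-odd : ∀ j → numP m n (suc (2 * j)) ≡ + 0
  numP-odd j = evenSum (suc n) (λ k _ eq → even≢odd k j (sym eq))

oneMinusX·-suc : ∀ f {d d′} → d ≡ suc d′ → oneMinusX· f d ≡ f d - f d′
oneMinusX·-suc f refl = refl

+[m+n]-+m≡+n : ∀ a b → + (a + b) - + a ≡ + b
+[m+n]-+m≡+n a b = trans (ℤ.m-n≡m⊖n (a + b) a) (trans (ℤ.⊖-≥ (m≤m+n a b)) (cong +_ (m+n∸m≡n a b)))

module Coefficients (m n : ℕ) where
  open Numerators m n

  sphereCountAt : Parity → ℕ → ℕ
  sphereCountAt 0ℙ j = m ^ (j ⊓ n)
  sphereCountAt 1ℙ j = if n ≤ᵇ j then m ^ n else 0

  sphereCount : ℕ → ℕ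
  sphereCount d = sphereCountAt (parity d) ⌊ d /2⌋

  ballCount : ℕ → ℕ
  ballCount d = powSum m (⌊ d /2⌋ ⊓ n)

  sphereCount-even : ∀ j → sphereCount (2 * j) ≡ m ^ (j ⊓ n)
  sphereCount-even j = cong₂ sphereCountAt (parity-even j) (⌊2*n/2⌋≡n j)

  sphereCount-odd : ∀ j → sphereCount (suc (2 * j)) ≡ sphereCountAt 1ℙ j
  sphereCount-odd j = cong₂ sphereCountAt (parity-odd j) (⌊1+2*n/2⌋≡n j)

  sphereCount-odd-≥ : ∀ {j} → n ≤ j → sphereCount (suc (2 * j)) ≡ m ^ n
  sphereCount-odd-≥ {j} n≤j with n ≤ᵇ j | ≤⇒≤ᵇ n≤j | sphereCount-odd j
  ... | true | _ | eq = eq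

  sphereCount-odd-< : ∀ {j} → j < n → sphereCount (suc (2 * j)) ≡ 0
  sphereCount-odd-< {j} j<n with n ≤ᵇ j | ≤ᵇ⇒≤ n j | sphereCount-odd j
  ... | true  | n≤j | _  = ⊥-elim (<⇒≱ j<n (n≤j _))
  ... | false | _   | eq = eq

  ballCount-even : ∀ j → ballCount (2 * j) ≡ powSum m (j ⊓ n)
  ballCount-even j = cong (λ k → powSum m (k ⊓ n)) (⌊2*n/2⌋≡n j)

  ballCount-odd : ∀ j → ballCount (suc (2 * j)) ≡ powSum m (j ⊓ n)
  ballCount-odd j = cong (λ k → powSum m (k ⊓ n)) (⌊1+2*n/2⌋≡n j)

  sphere-series : ∀ d → oneMinusX· (toPS sphereCount) d ≡ numR m n d
  sphere-series d with evenOdd d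
  ... | even zero    = sym (numR-even-≤ z≤n)
  ... | even (suc j) = trans (oneMinusX·-suc (toPS sphereCount) (2*-suc j)) (step (suc j ≤? n))
    where
    step : Dec (suc j ≤ n) → + sphereCount (2 * suc j) - + sphereCount (suc (2 * j)) ≡ numR m n (2 * suc j)
    step (yes j<n) rewrite sphereCount-even (suc j) | m≤n⇒m⊓n≡m j<n | sphereCount-odd-< j<n =
      trans (ℤ.+-identityʳ _) (sym (numR-even-≤ j<n))
    step (no j≮n) rewrite sphereCount-even (suc j) | m≥n⇒m⊓n≡n (<⇒≤ (≰⇒> j≮n))
                        | sphereCount-odd-≥ (≤-pred (≰⇒> j≮n)) =
      trans (ℤ.+-inverseʳ (+ (m ^ n))) (sym (numR-even-> (≰⇒> j≮n)))
  ... | odd j        = step (j <? n)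
    where
    step : Dec (j < n) → + sphereCount (suc (2 * j)) - + sphereCount (2 * j) ≡ numR m n (suc (2 * j))
    step (yes j<n) rewrite sphereCount-odd-< j<n | sphereCount-even j | m≤n⇒m⊓n≡m (<⇒≤ j<n) =
      trans (ℤ.+-identityˡ _) (sym (numR-odd-< j<n))
    step (no j≮n) rewrite sphereCount-odd-≥ (≮⇒≥ j≮n) | sphereCount-even j | m≥n⇒m⊓n≡n (≮⇒≥ j≮n) =
      trans (ℤ.+-inverseʳ (+ (m ^ n))) (sym (numR-odd-≥ (≮⇒≥ j≮n)))

  ball-series : ∀ d → oneMinusX· (toPS ballCount) d ≡ numP m n d
  ball-series d with evenOdd d
  ... | even zero    = sym (numP-even-≤ z≤n)
  ... | even (suc j) = trans (oneMinusX·-suc (toPS ballCount) (2*-suc j)) (step (suc j ≤? n))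
    where
    step : Dec (suc j ≤ n) → + ballCount (2 * suc j) - + ballCount (suc (2 * j)) ≡ numP m n (2 * suc j)
    step (yes j<n) rewrite ballCount-even (suc j) | ballCount-odd j
                         | m≤n⇒m⊓n≡m j<n | m≤n⇒m⊓n≡m (<⇒≤ j<n) =
      trans (+[m+n]-+m≡+n (powSum m j) (m ^ suc j)) (sym (numP-even-≤ j<n))
    step (no j≮n) rewrite ballCount-even (suc j) | ballCount-odd j
                        | m≥n⇒m⊓n≡n (<⇒≤ (≰⇒> j≮n)) | m≥n⇒m⊓n≡n (≤-pred (≰⇒> j≮n)) =
      trans (ℤ.+-inverseʳ (+ (powSum m n))) (sym (numP-even-> (≰⇒> j≮n)))
  ... | odd j        rewrite ballCount-odd j | ballCount-even j =
    trans (ℤ.+-inverseʳ (+ (powSum m (j ⊓ n)))) (sym (numP-odd j))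

-- Walks and distances in the tree

module WalkProperties {V : Set} (Adj : V → V → Set) (Basin : V → Set) where
  open GraphNotions Adj Basin

  infixr 5 _++ʷ_
  _++ʷ_ : ∀ {a b u w x} → Walk a u w → Walk b w x → Walk (a + b) u x
  nil      ++ʷ w′ = w′
  cons e w ++ʷ w′ = cons e (w ++ʷ w′)

  castʷ : ∀ {d d′ u u′ x x′} → d ≡ d′ → u ≡ u′ → x ≡ x′ → Walk d u x → Walk d′ u′ x′
  castʷ refl refl refl w = w

  module _ (Adj-sym : ∀ {u w} → Adj u w → Adj w u) where

    reverseʷ : ∀ {d u x} → Walk d u x → Walk d x u
    reverseʷ nil        = nil
    reverseʷ (cons e w) = castʷ (+-comm _ 1) refl refl (reverseʷ w ++ʷ cons (Adj-sym e) nil)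

    oscillate : ∀ {u w} → Adj u w → ∀ t → Walk (2 * t) u u
    oscillate e zero    = nil
    oscillate e (suc t) = castʷ (sym (2*-suc t)) refl refl (cons e (cons (Adj-sym e) (oscillate e t)))

  HasCard-⇔ : ∀ {Q Q′ : V → Set} {c} → (∀ x → Q x ⇔ Q′ x) → HasCard Q c → HasCard Q′ c
  HasCard-⇔ Q⇔Q′ (L , unique , (sound , complete) , len) =
    L , unique , ((λ x x∈ → to (Q⇔Q′ x) (sound x x∈)) , (λ x q → complete x (from (Q⇔Q′ x) q))) , len
    where open Equivalence

module TreeGeometry (m : ℕ) where
  open GraphNotions (BAdj m) (BBasin m) public
  open WalkProperties (BAdj m) (BBasin m) public

  depth : BVertex m → ℕ
  depth (_ , l) = length l

  BAdj-sym : ∀ {u w} → BAdj m u w → BAdj m w u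
  BAdj-sym (down i) = up i
  BAdj-sym (up i)   = down i
  BAdj-sym cross    = cross'
  BAdj-sym cross'   = cross

  BAdj-depth : ∀ {u w} → BAdj m u w → depth u ≤ suc (depth w)
  BAdj-depth (down i) = m≤n⇒m≤1+n (n≤1+n _)
  BAdj-depth (up i)   = ≤-refl
  BAdj-depth cross    = z≤n
  BAdj-depth cross'   = z≤n

  neighbour : ∀ u → Σ (BVertex m) (BAdj m u)
  neighbour (s     , i ∷ l) = (s , l) , up i
  neighbour (true  , [])    = (false , []) , cross
  neighbour (false , [])    = (true , []) , cross'

  roots-adjacent : ∀ {s s′} → s ≢ s′ → BAdj m (s , []) (s′ , [])
  roots-adjacent {true}  {false} _    = cross
  roots-adjacent {false} {true}  _    = cross'
  roots-adjacent {true}  {true}  s≢s′ = ⊥-elim (s≢s′ refl)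
  roots-adjacent {false} {false} s≢s′ = ⊥-elim (s≢s′ refl)

  idle : ∀ t {u} → Walk (2 * t) u u
  idle t {u} = oscillate BAdj-sym (proj₂ (neighbour u)) t

  ascend : ∀ s q c → Walk (length q) (s , q ++ c) (s , c)
  ascend s []      c = nil
  ascend s (i ∷ q) c = cons (up i) (ascend s q c)

  descend : ∀ s p c → Walk (length p) (s , c) (s , p ++ c)
  descend s p c = reverseʷ BAdj-sym (ascend s p c)

  InP⇔depth≤ : ∀ k x → InP k x ⇔ depth x ≤ k
  InP⇔depth≤ k x = mk⇔ (to k x) (from k x)
    where
    to : ∀ k x → InP k x → depth x ≤ k
    to zero    (s , []) refl                = z≤n
    to (suc k) x        (y , y∈ , inj₁ refl) = m≤n⇒m≤1+n (to k y y∈)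
    to (suc k) x        (y , y∈ , inj₂ e)    = ≤-trans (BAdj-depth e) (s≤s (to k y y∈))
    from : ∀ k x → depth x ≤ k → InP k x
    from zero    (s , [])    _         = refl
    from (suc k) (s , [])    _         = (s , []) , from k (s , []) z≤n , inj₁ refl
    from (suc k) (s , i ∷ l) (s≤s l≤k) = (s , l) , from k (s , l) l≤k , inj₂ (up i)

  InR⇔depth≡ : ∀ k x → InR k x ⇔ depth x ≡ k
  InR⇔depth≡ zero    (s , [])    = mk⇔ (λ _ → refl) (λ _ → refl)
  InR⇔depth≡ zero    (s , _ ∷ _) = mk⇔ (λ ()) (λ ())
  InR⇔depth≡ (suc k) x = mk⇔
    (λ (x∈ , x∉) → ≤-antisym (to (InP⇔depth≤ (suc k) x) x∈) (≰⇒> (x∉ ∘ from (InP⇔depth≤ k x))))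
    (λ x≡ → from (InP⇔depth≤ (suc k) x) (≤-reflexive x≡) , λ x∈ → 1+n≰n (subst (_≤ k) x≡ (to (InP⇔depth≤ k x) x∈)))
    where open Equivalence

  -- Shape d u x: dist(u, x) ≤ d with even slack 2e.  On one side of the basin edge
  -- the geodesic climbs q and descends p below the common suffix c; across the
  -- edge it runs through both roots.
  data Shape (d : ℕ) : BVertex m → BVertex m → Set where
    sameSide  : ∀ {s lu lx} q p c e → lu ≡ q ++ c → lx ≡ p ++ c →
                d ≡ length q + length p + 2 * e → Shape d (s , lu) (s , lx)
    otherSide : ∀ {s s′ lu lx} e → s ≢ s′ →
                d ≡ length lu + length lx + suc (2 * e) → Shape d (s , lu) (s′ , lx)

  shape→walk : ∀ {d u x} → Shape d u x → Walk d u x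
  shape→walk (sameSide {s} q p c e refl refl refl) =
    castʷ (sym (+-assoc (length q) (length p) (2 * e))) refl refl (ascend s q c ++ʷ descend s p c ++ʷ idle e)
  shape→walk (otherSide {s} {s′} {lu} {lx} e s≢s′ refl) =
    castʷ (length-eq (length lu) (length lx) e) (cong (s ,_) (++-identityʳ lu)) (cong (s′ ,_) (++-identityʳ lx))
          (ascend s lu [] ++ʷ cons (roots-adjacent s≢s′) (descend s′ lx [] ++ʷ idle e))
    where
    length-eq : ∀ a b e → a + suc (b + 2 * e) ≡ a + b + suc (2 * e)
    length-eq = solve-∀

  shape-cross : ∀ {s s′ d x} → s ≢ s′ → Shape d (s′ , []) x → Shape (suc d) (s , []) x
  shape-cross s≢s′ (sameSide [] p [] e refl refl refl) =
    otherSide e s≢s′ (trans (sym (+-suc (length p) (2 * e)))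
                            (cong (λ l → length l + suc (2 * e)) (sym (++-identityʳ p))))
  shape-cross {s} {d = d} s≢s′ (otherSide {lx = lx} e s′≢s″ refl) =
    subst (λ t → Shape (suc d) (s , []) (t , lx))
          (trans (¬-not s≢s′) (trans (cong not (¬-not s′≢s″)) (not-involutive _)))
          (sameSide [] lx [] (suc e) refl (sym (++-identityʳ lx)) (length-eq (length lx) e))
    where
    length-eq : ∀ b e → suc (b + suc (2 * e)) ≡ b + 2 * suc e
    length-eq = solve-∀

  shape-step : ∀ {d u w x} → BAdj m u w → Shape d w x → Shape (suc d) u x
  shape-step (down {l = l} i) (sameSide [] p c e refl eqx refl) =
    sameSide [] (p ++ [ i ]) l e refl (trans eqx (sym (++-assoc p [ i ] l)))
             (trans (length-eq (length p) e) (cong (_+ 2 * e) (sym (length-++ p))))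
    where
    length-eq : ∀ b e → suc (b + 2 * e) ≡ b + 1 + 2 * e
    length-eq = solve-∀
  shape-step (down i) (sameSide (j ∷ q) p c e eqw eqx refl) =
    sameSide q p c (suc e) (proj₂ (∷-injective eqw)) eqx (length-eq (length q) (length p) e)
    where
    length-eq : ∀ a b e → suc (suc a + b + 2 * e) ≡ a + b + 2 * suc e
    length-eq = solve-∀
  shape-step (down {l = l} i) (otherSide {lx = lx} e s≢s′ refl) =
    otherSide (suc e) s≢s′ (length-eq (length l) (length lx) e)
    where
    length-eq : ∀ a b e → suc (suc a + b + suc (2 * e)) ≡ a + b + suc (2 * suc e)
    length-eq = solve-∀
  shape-step (up i) (sameSide q p c e eqw eqx eqd) = sameSide (i ∷ q) p c e (cong (i ∷_) eqw) eqx (cong suc eqd)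
  shape-step (up i) (otherSide e s≢s′ eqd)         = otherSide e s≢s′ (cong suc eqd)
  shape-step cross  σ = shape-cross (λ ()) σ
  shape-step cross' σ = shape-cross (λ ()) σ

  walk⇔shape : ∀ d u x → Walk d u x ⇔ Shape d u x
  walk⇔shape d u x = mk⇔ walk→shape shape→walk
    where
    walk→shape : ∀ {d u x} → Walk d u x → Shape d u x
    walk→shape {u = s , l} nil = sameSide [] [] l 0 refl refl refl
    walk→shape (cons e w)      = shape-step e (walk→shape w)

-- Counting around a vertex of depth n

module Neighbourhoods (m n : ℕ) (r : List (Fin m)) (|r|≡n : length r ≡ n) where
  open TreeGeometry m
  open Words m
  open Coefficients m n

  v : BVertex m
  v = (true , r)

  private
    double-split : ∀ a e → a + a + 2 * e ≡ 2 * (a + e)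
    double-split = solve-∀

    crossing-length : ∀ a e → a + a + suc (2 * e) ≡ suc (2 * (a + e))
    crossing-length = solve-∀

  |q|+|c|≡n : ∀ q c → r ≡ q ++ c → length q + length c ≡ n
  |q|+|c|≡n q c eqr = trans (sym (length-++ q)) (trans (cong length (sym eqr)) |r|≡n)

  length-++-drop : ∀ p i → length (p ++ drop i r) ≡ length p + (n ∸ i)
  length-++-drop p i = trans (length-++ p) (cong (λ a → length p + a) (trans (length-drop i r) (cong (_∸ i) |r|≡n)))

  prefix-≤ : ∀ q c → r ≡ q ++ c → length q ≤ n
  prefix-≤ q c eqr = subst (length q ≤_) (|q|+|c|≡n q c eqr) (m≤m+n _ _)

  equal-legs : ∀ q p c {lx} → r ≡ q ++ c → lx ≡ p ++ c → length lx ≡ n → length q ≡ length p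
  equal-legs q p c eqr refl |lx|≡n =
    +-cancelʳ-≡ (length c) (length q) (length p) (trans (|q|+|c|≡n q c eqr) (trans (sym |lx|≡n) (length-++ p)))

  shorter-leg : ∀ q p c {lx} → r ≡ q ++ c → lx ≡ p ++ c → length lx ≤ n → length p ≤ length q
  shorter-leg q p c eqr refl |lx|≤n =
    +-cancelʳ-≤ (length c) (length p) (length q) (subst₂ _≤_ (length-++ p) (sym (|q|+|c|≡n q c eqr)) |lx|≤n)

  sameSide-even : ∀ q p c e {d lx} → r ≡ q ++ c → lx ≡ p ++ c → length lx ≡ n →
                  d ≡ length q + length p + 2 * e → d ≡ 2 * (length q + e)
  sameSide-even q p c e eqr eqx |lx|≡n refl =
    trans (cong (λ b → length q + b + 2 * e) (sym (equal-legs q p c eqr eqx |lx|≡n))) (double-split (length q) e)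

  otherSide-odd : ∀ {d} e (lx : List (Fin m)) → length lx ≡ n →
                  d ≡ length r + length lx + suc (2 * e) → d ≡ suc (2 * (n + e))
  otherSide-odd e lx |lx|≡n refl = trans (cong₂ (λ a b → a + b + suc (2 * e)) |r|≡n |lx|≡n) (crossing-length n e)

  even-shape-stays : ∀ {j} {x : BVertex m} → depth x ≡ n → Shape (2 * j) v x →
                     proj₁ x ≡ true × drop (j ⊓ n) (proj₂ x) ≡ drop (j ⊓ n) r
  even-shape-stays {j} |lx|≡n (sameSide q p c e eqr eqx eqd) = refl , (begin
    drop (j ⊓ n) _       ≡⟨ cong (drop (j ⊓ n)) eqx ⟩
    drop (j ⊓ n) (p ++ c) ≡⟨ drop-++-common p q c (sym (equal-legs q p c eqr eqx |lx|≡n)) p≤j⊓n ⟩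
    drop (j ⊓ n) (q ++ c) ≡⟨ cong (drop (j ⊓ n)) (sym eqr) ⟩
    drop (j ⊓ n) r        ∎)
    where
    open ≡-Reasoning
    q≤j : length q ≤ j
    q≤j = subst (length q ≤_) (sym (2*-injective (sameSide-even q p c e eqr eqx |lx|≡n eqd))) (m≤m+n _ e)
    p≤j⊓n : length p ≤ j ⊓ n
    p≤j⊓n = subst (_≤ j ⊓ n) (equal-legs q p c eqr eqx |lx|≡n) (⊓-glb q≤j (prefix-≤ q c eqr))
  even-shape-stays {j} |lx|≡n (otherSide {lx = lx} e _ eqd) =
    ⊥-elim (even≢odd j (n + e) (otherSide-odd e lx |lx|≡n eqd))

  sphere-even-card : ∀ j → HasCard (λ x → depth x ≡ n × Shape (2 * j) v x) (m ^ (j ⊓ n))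
  sphere-even-card j = map lift (words K) , Unique.map⁺ lift-injective (words-unique K) , (sound , complete) ,
                       trans (length-map lift (words K)) (length-words K)
    where
    K : ℕ
    K = j ⊓ n

    |take-K| : ∀ {l : List (Fin m)} → length l ≡ n → length (take K l) ≡ K
    |take-K| {l} |l|≡n = length-take-≤ l (subst (K ≤_) (sym |l|≡n) (m⊓n≤n j n))

    lift : List (Fin m) → BVertex m
    lift p = (true , p ++ drop K r)

    lift-injective : ∀ {p p′} → lift p ≡ lift p′ → p ≡ p′
    lift-injective {p} {p′} eq = ++-cancelʳ (drop K r) p p′ (cong proj₂ eq)

    sound : ∀ x → x ∈ map lift (words K) → depth x ≡ n × Shape (2 * j) v x
    sound x x∈ with ∈-map⁻ lift x∈
    ... | p , p∈ , refl = |lift-p| , sameSide (take K r) p (drop K r) (j ∸ K) (sym (take++drop≡id K r)) refl 2j≡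
      where
      |p| : length p ≡ K
      |p| = ∈-words⁻ K p∈
      |lift-p| : length (p ++ drop K r) ≡ n
      |lift-p| = trans (length-++-drop p K) (trans (cong (_+ (n ∸ K)) |p|) (m+[n∸m]≡n (m⊓n≤n j n)))
      2j≡ : 2 * j ≡ length (take K r) + length p + 2 * (j ∸ K)
      2j≡ = trans (cong (2 *_) (sym (m+[n∸m]≡n (m⊓n≤m j n))))
                  (trans (sym (double-split K (j ∸ K)))
                         (cong₂ (λ a b → a + b + 2 * (j ∸ K)) (sym (|take-K| |r|≡n)) (sym |p|)))

    complete : ∀ x → depth x ≡ n × Shape (2 * j) v x → x ∈ map lift (words K)
    complete (_ , lx) (|lx|≡n , σ) with even-shape-stays {j} |lx|≡n σ
    ... | refl , agrees =
      subst (_∈ map lift (words K)) (cong (true ,_) (trans (cong (take K lx ++_) (sym agrees)) (take++drop≡id K lx)))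
            (∈-map⁺ lift (subst (λ k → take K lx ∈ words k) (|take-K| |lx|≡n) (∈-words⁺ (take K lx))))

  odd-shape-crosses : ∀ {j} {x : BVertex m} → depth x ≡ n → Shape (suc (2 * j)) v x →
                      proj₁ x ≡ false × n ≤ j
  odd-shape-crosses {j} |lx|≡n (sameSide q p c e eqr eqx eqd) =
    ⊥-elim (even≢odd (length q + e) j (sym (sameSide-even q p c e eqr eqx |lx|≡n eqd)))
  odd-shape-crosses |lx|≡n (otherSide {s′ = false} {lx = lx} e _ eqd) =
    refl , subst (n ≤_) (sym (2*-injective (suc-injective (otherSide-odd e lx |lx|≡n eqd)))) (m≤m+n n e)
  odd-shape-crosses _ (otherSide {s′ = true} e true≢true _) = ⊥-elim (true≢true refl)

  opposite : List (Fin m) → BVertex m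
  opposite p = (false , p)

  sphere-odd-far-card : ∀ {j} → n ≤ j → HasCard (λ x → depth x ≡ n × Shape (suc (2 * j)) v x) (m ^ n)
  sphere-odd-far-card {j} n≤j =
    map opposite (words n) , Unique.map⁺ (cong proj₂) (words-unique n) , (sound , complete) ,
    trans (length-map opposite (words n)) (length-words n)
    where
    sound : ∀ x → x ∈ map opposite (words n) → depth x ≡ n × Shape (suc (2 * j)) v x
    sound x x∈ with ∈-map⁻ opposite x∈
    ... | p , p∈ , refl = ∈-words⁻ n p∈ , otherSide (j ∸ n) (λ ()) (sym (trans
            (cong₂ (λ a b → a + b + suc (2 * (j ∸ n))) |r|≡n (∈-words⁻ n p∈))
            (trans (crossing-length n (j ∸ n)) (cong (λ i → suc (2 * i)) (m+[n∸m]≡n n≤j)))))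

    complete : ∀ x → depth x ≡ n × Shape (suc (2 * j)) v x → x ∈ map opposite (words n)
    complete (_ , lx) (|lx|≡n , σ) with odd-shape-crosses {j} |lx|≡n σ
    ... | refl , _ = ∈-map⁺ opposite (subst (λ k → lx ∈ words k) |lx|≡n (∈-words⁺ lx))

  sphere-odd-near-card : ∀ {j} → j < n → HasCard (λ x → depth x ≡ n × Shape (suc (2 * j)) v x) 0
  sphere-odd-near-card {j} j<n = [] , [] , ((λ _ ()) , complete) , refl
    where
    complete : ∀ x → depth x ≡ n × Shape (suc (2 * j)) v x → x ∈ []
    complete _ (|x|≡n , σ) = ⊥-elim (<⇒≱ j<n (proj₂ (odd-shape-crosses {j} |x|≡n σ)))

  sphere-card : ∀ d → HasCard (λ x → depth x ≡ n × Shape d v x) (sphereCount d)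
  sphere-card d with evenOdd d
  ... | even j = subst (HasCard _) (sym (sphereCount-even j)) (sphere-even-card j)
  ... | odd j with j <? n
  ...   | yes j<n = subst (HasCard _) (sym (sphereCount-odd-< j<n)) (sphere-odd-near-card j<n)
  ...   | no j≮n  = subst (HasCard _) (sym (sphereCount-odd-≥ (≮⇒≥ j≮n))) (sphere-odd-far-card (≮⇒≥ j≮n))

  sideAfter : Parity → Bool
  sideAfter 0ℙ = true
  sideAfter 1ℙ = false

  -- The end of the d-step walk from v that climbs d − |p| steps and then descends
  -- along p; if the root is reached first, the surplus is spent idling, crossing
  -- the basin edge iff it is odd.
  climbDescend : ℕ → List (Fin m) → BVertex m
  climbDescend d p with d ∸ length p ≤? n
  ... | yes _ = (true , p ++ drop (d ∸ length p) r)
  ... | no  _ = (sideAfter (parity (d ∸ (length p + n))) , p)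

  climbDescend-climb : ∀ {d} p {i} → d ≡ length p + i → i ≤ n → climbDescend d p ≡ (true , p ++ drop i r)
  climbDescend-climb {d} p {i} d≡ i≤n
    with d ∸ length p ≤? n | trans (cong (_∸ length p) d≡) (m+n∸m≡n (length p) i)
  ... | yes _   | d∸|p|≡i = cong (λ k → (true , p ++ drop k r)) d∸|p|≡i
  ... | no i≰n | d∸|p|≡i = ⊥-elim (i≰n (subst (_≤ n) (sym d∸|p|≡i) i≤n))

  climbDescend-root : ∀ {d} p {w} → d ≡ length p + n + w → 0 < w →
                      climbDescend d p ≡ (sideAfter (parity w) , p)
  climbDescend-root {d} p {w} d≡ 0<w with d ∸ length p ≤? n
  ... | yes ≤n = ⊥-elim (<⇒≱ (m<m+n n 0<w) (subst (_≤ n) d∸|p|≡n+w ≤n))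
    where d∸|p|≡n+w = trans (cong (_∸ length p) (trans d≡ (+-assoc (length p) n w))) (m+n∸m≡n (length p) (n + w))
  ... | no _   = cong (λ k → (sideAfter (parity k) , p))
                      (trans (cong (_∸ (length p + n)) d≡) (m+n∸m≡n (length p + n) w))

  depth-climbDescend : ∀ d p → depth (climbDescend d p) ≡ length p + (n ∸ (d ∸ length p))
  depth-climbDescend d p with d ∸ length p ≤? n
  ... | yes _   = length-++-drop p (d ∸ length p)
  ... | no i≰n = sym (trans (cong (λ a → length p + a) (m≤n⇒m∸n≡0 (<⇒≤ (≰⇒> i≰n)))) (+-identityʳ (length p)))

  take-climbDescend : ∀ d p → take (length p) (proj₂ (climbDescend d p)) ≡ p
  take-climbDescend d p with d ∸ length p ≤? n
  ... | yes _ = take-length-++ p _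
  ... | no  _ = take-all (length p) p ≤-refl

  climbDescend-injective : ∀ d {p p′} → climbDescend d p ≡ climbDescend d p′ → p ≡ p′
  climbDescend-injective d {p} {p′} eq = begin
    p                                            ≡⟨ sym (take-climbDescend d p) ⟩
    take (length p) (proj₂ (climbDescend d p))   ≡⟨ cong₂ (λ k x → take k (proj₂ x)) |p|≡|p′| eq ⟩
    take (length p′) (proj₂ (climbDescend d p′)) ≡⟨ take-climbDescend d p′ ⟩
    p′                                           ∎
    where
    open ≡-Reasoning
    |p|≡|p′| : length p ≡ length p′
    |p|≡|p′| = strictlyIncreasing-injective (λ k → k + (n ∸ (d ∸ k)))
      (λ k<k′ → +-mono-<-≤ k<k′ (∸-monoʳ-≤ n (∸-monoʳ-≤ d (<⇒≤ k<k′))))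
      (trans (sym (depth-climbDescend d p)) (trans (cong depth eq) (depth-climbDescend d p′)))

  |p|+n≡|r|+|p| : ∀ (p : List (Fin m)) → length p + n ≡ length r + length p
  |p|+n≡|r|+|p| p = trans (+-comm (length p) n) (cong (_+ length p) (sym |r|≡n))

  root-shape : ∀ {d} p w → d ≡ length p + n + w → Shape d v (sideAfter (parity w) , p)
  root-shape p w d≡ with evenOdd w
  ... | even e rewrite parity-even e =
    sameSide r p [] e (sym (++-identityʳ r)) (sym (++-identityʳ p))
             (trans d≡ (cong (_+ 2 * e) (|p|+n≡|r|+|p| p)))
  ... | odd e rewrite parity-odd e =
    otherSide e (λ ()) (trans d≡ (cong (_+ suc (2 * e)) (|p|+n≡|r|+|p| p)))

  ball-sound : ∀ d p → 2 * length p ≤ d → length p ≤ n →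
               depth (climbDescend d p) ≤ n × Shape d v (climbDescend d p)
  ball-sound d p 2k≤d k≤n with d ∸ length p ≤? n
  ... | yes i≤n = |p++drop-i-r|≤n , sameSide (take i r) p (drop i r) 0 (sym (take++drop≡id i r)) refl d≡
    where
    i = d ∸ length p
    k≤d : length p ≤ d
    k≤d = ≤-trans (m≤m+n (length p) (length p + 0)) 2k≤d
    k≤i : length p ≤ i
    k≤i = m+n≤o⇒m≤o∸n (length p) (subst (_≤ d) (cong (λ a → length p + a) (+-identityʳ (length p))) 2k≤d)
    |p++drop-i-r|≤n : length (p ++ drop i r) ≤ n
    |p++drop-i-r|≤n = subst (_≤ n) (sym (length-++-drop p i))
                            (subst (length p + (n ∸ i) ≤_) (m+[n∸m]≡n i≤n) (+-monoˡ-≤ (n ∸ i) k≤i))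
    d≡ : d ≡ length (take i r) + length p + 2 * 0
    d≡ = sym (trans (cong (λ a → a + length p + 0) (length-take-≤ r (subst (i ≤_) (sym |r|≡n) i≤n)))
                    (trans (+-identityʳ _) (m∸n+n≡m k≤d)))
  ... | no i≰n = k≤n , root-shape p (d ∸ (length p + n)) (sym (m+[n∸m]≡n kn≤d))
    where
    kn≤d : length p + n ≤ d
    kn≤d = subst (_≤ d) (+-comm n (length p))
                 (m≤o∸n⇒m+n≤o n (≤-trans (m≤m+n (length p) (length p + 0)) 2k≤d) (<⇒≤ (≰⇒> i≰n)))

  Preimage : ℕ → BVertex m → Set
  Preimage d x = Σ (List (Fin m)) λ p → (2 * length p ≤ d × length p ≤ n) × climbDescend d p ≡ x

  preimage-climb : ∀ q p c e {lx} → r ≡ q ++ c → lx ≡ p ++ c → length p ≤ length q → e ≤ length c →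
                   Preimage (length q + length p + 2 * e) (true , lx)
  preimage-climb q p c e {lx} eqr eqx p≤q e≤c =
    p′ , (2k≤d , subst (_≤ n) (sym |p′|) (≤-trans (+-monoˡ-≤ e p≤q) i≤n)) ,
    trans (climbDescend-climb p′ d≡ i≤n) (cong (true ,_) lx≡)
    where
    p′ = p ++ take e c
    d = length q + length p + 2 * e
    |p′| : length p′ ≡ length p + e
    |p′| = trans (length-++ p) (cong (λ a → length p + a) (length-take-≤ c e≤c))
    i≤n : length q + e ≤ n
    i≤n = subst (length q + e ≤_) (|q|+|c|≡n q c eqr) (+-monoʳ-≤ (length q) e≤c)
    d≡ : d ≡ length p′ + (length q + e)
    d≡ = trans (legs-swap (length q) (length p) e) (cong (_+ (length q + e)) (sym |p′|))
      where
      legs-swap : ∀ b a e → b + a + 2 * e ≡ a + e + (b + e)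
      legs-swap = solve-∀
    2k≤d : 2 * length p′ ≤ d
    2k≤d = subst (λ k → 2 * k ≤ d) (sym |p′|)
             (subst (_≤ d) (double-split (length p) e) (+-monoˡ-≤ (2 * e) (+-monoˡ-≤ (length p) p≤q)))
    lx≡ : p′ ++ drop (length q + e) r ≡ lx
    lx≡ = begin
      p′ ++ drop (length q + e) r        ≡⟨ cong (λ l → p′ ++ drop (length q + e) l) eqr ⟩
      p′ ++ drop (length q + e) (q ++ c) ≡⟨ cong (p′ ++_) (drop-length-++ q e c) ⟩
      (p ++ take e c) ++ drop e c        ≡⟨ ++-assoc p (take e c) (drop e c) ⟩
      p ++ (take e c ++ drop e c)        ≡⟨ cong (p ++_) (take++drop≡id e c) ⟩
      p ++ c                             ≡⟨ sym eqx ⟩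
      lx                                 ∎
      where open ≡-Reasoning

  preimage-return : ∀ q p c e {lx} → r ≡ q ++ c → lx ≡ p ++ c → length lx ≤ n →
                    length p ≤ length q → length c < e →
                    Preimage (length q + length p + 2 * e) (true , lx)
  preimage-return q p c e {lx} eqr eqx |lx|≤n p≤q c<e =
    lx , (2L≤d , |lx|≤n) , trans (climbDescend-root lx d≡ 0<w) (cong (λ b → (sideAfter b , lx)) (parity-even t))
    where
    t = e ∸ length c
    d = length q + length p + 2 * e
    0<w : 0 < 2 * t
    0<w = <-≤-trans (m<n⇒0<n∸m c<e) (m≤m+n t (t + 0))
    |lx|≡p+c : length lx ≡ length p + length c
    |lx|≡p+c = trans (cong length eqx) (length-++ p)
    d≡ : d ≡ length lx + n + 2 * t
    d≡ = trans (cong (λ e′ → length q + length p + 2 * e′) (sym (m+[n∸m]≡n (<⇒≤ c<e))))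
               (trans (excess-split (length p) (length q) (length c) t)
                      (cong₂ (λ a b → a + b + 2 * t) (sym |lx|≡p+c) (|q|+|c|≡n q c eqr)))
      where
      excess-split : ∀ a b c t → b + a + 2 * (c + t) ≡ a + c + (b + c) + 2 * t
      excess-split = solve-∀
    2L≤d : 2 * length lx ≤ d
    2L≤d = subst (λ k → 2 * k ≤ d) (sym |lx|≡p+c)
             (subst (_≤ d) (double-split (length p) (length c))
                    (+-mono-≤ (+-monoˡ-≤ (length p) p≤q) (*-monoʳ-≤ 2 (<⇒≤ c<e))))

  preimage-cross : ∀ {d} e lx → length lx ≤ n → d ≡ length r + length lx + suc (2 * e) → Preimage d (false , lx)
  preimage-cross {d} e lx |lx|≤n eqd =
    lx , (2L≤d , |lx|≤n) , trans (climbDescend-root lx d≡ (s≤s z≤n)) (cong (λ b → (sideAfter b , lx)) (parity-odd e))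
    where
    d≡ : d ≡ length lx + n + suc (2 * e)
    d≡ = trans eqd (cong (_+ suc (2 * e)) (sym (|p|+n≡|r|+|p| lx)))
    2L≤d : 2 * length lx ≤ d
    2L≤d = subst (2 * length lx ≤_) (sym d≡)
             (≤-trans (2*m≤n+m |lx|≤n) (≤-trans (≤-reflexive (+-comm n (length lx))) (m≤m+n _ _)))

  ball-complete : ∀ {d} x → depth x ≤ n → Shape d v x → Preimage d x
  ball-complete _ |lx|≤n (sameSide {lx = lx} q p c e eqr eqx refl) with e ≤? length c
  ... | yes e≤c = preimage-climb q p c e eqr eqx (shorter-leg q p c eqr eqx |lx|≤n) e≤c
  ... | no e≰c  = preimage-return q p c e eqr eqx |lx|≤n (shorter-leg q p c eqr eqx |lx|≤n) (≰⇒> e≰c)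
  ball-complete (false , lx) |lx|≤n (otherSide e _ eqd)            = preimage-cross e lx |lx|≤n eqd
  ball-complete (true  , lx) _      (otherSide e true≢true _)      = ⊥-elim (true≢true refl)

  ball-card : ∀ d → HasCard (λ x → depth x ≤ n × Shape d v x) (ballCount d)
  ball-card d = map (climbDescend d) (wordsUpTo K) , Unique.map⁺ (climbDescend-injective d) (wordsUpTo-unique K) ,
                (sound , complete) , trans (length-map (climbDescend d) (wordsUpTo K)) (length-wordsUpTo K)
    where
    K = ⌊ d /2⌋ ⊓ n
    sound : ∀ x → x ∈ map (climbDescend d) (wordsUpTo K) → depth x ≤ n × Shape d v x
    sound x x∈ with ∈-map⁻ (climbDescend d) x∈
    ... | p , p∈ , refl = ball-sound d p (m≤⌊n/2⌋⇒2*m≤n (≤-trans |p|≤K (m⊓n≤m _ _))) (≤-trans |p|≤K (m⊓n≤n _ _))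
      where |p|≤K = ∈-wordsUpTo⁻ K p∈
    complete : ∀ x → depth x ≤ n × Shape d v x → x ∈ map (climbDescend d) (wordsUpTo K)
    complete x (x≤n , σ) with ball-complete x x≤n σ
    ... | p , (2k≤d , k≤n) , refl = ∈-map⁺ (climbDescend d) (∈-wordsUpTo⁺ p (⊓-glb (2*m≤n⇒m≤⌊n/2⌋ 2k≤d) k≤n))

length-rayPath : ∀ {m} (ray : ℕ → Fin m) k → length (rayPath ray k) ≡ k
length-rayPath ray zero    = refl
length-rayPath ray (suc k) = cong suc (length-rayPath ray k)

proposition3p9 : (m : ℕ) → 2 ≤ m → (ray : ℕ → Fin m) → (n : ℕ) → 1 ≤ n →
    (Σ (ℕ → ℕ) λ c → GraphNotions.IsZeta (BAdj m) (BBasin m) (rayVertex ray n) c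
        × (∀ d → oneMinusX· (toPS c) d ≡ numR m n d))
    × (Σ (ℕ → ℕ) λ c → GraphNotions.IsZetaP (BAdj m) (BBasin m) (rayVertex ray n) c
        × (∀ d → oneMinusX· (toPS c) d ≡ numP m n d))
proposition3p9 m _ ray n _ =
    (sphereCount , (n , v∈ℛₙ , ζ-cards) , sphere-series)
  , (ballCount   , (n , v∈ℛₙ , ζᴾ-cards) , ball-series)
  where
  open TreeGeometry m
  open Coefficients m n
  open Neighbourhoods m n (rayPath ray n) (length-rayPath ray n)
  v∈ℛₙ : InR n v
  v∈ℛₙ = Equivalence.from (InR⇔depth≡ n v) (length-rayPath ray n)
  ζ-cards : ∀ d → HasCard (λ x → InR n x × Reachable d v x) (sphereCount d)
  ζ-cards d = HasCard-⇔ (λ x → ⇔.sym (InR⇔depth≡ n x ×-⇔ walk⇔shape d v x)) (sphere-card d)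
  ζᴾ-cards : ∀ d → HasCard (λ x → InP n x × Reachable d v x) (ballCount d)
  ζᴾ-cards d = HasCard-⇔ (λ x → ⇔.sym (InP⇔depth≤ n x ×-⇔ walk⇔shape d v x)) (ball-card d)
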